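{- Let $k\geq 2$ and $\mu$ be positive integers with $\mu\mid k-1$, put $n=(k^2-1)/\mu$, $a=(k-1)/\mu$, $b=k+1$, and let $\Gamma$ be the digraph with vertex set $\mathbb{Z}_n$ in which there is an arc $x\to y$ if and only if $x+ky\in\{1,2,\ldots,k\}$ (arithmetic modulo $n$). For $i\in\{0,1,\ldots,a-1\}$ let $$C_i=\{ib\}\cup\{k(s-ib)\,:\, s\in\{1,2,\ldots,k\}\}.$$ Then $\{C_0,\dots,C_{a-1}\}$ is a column equitable partition of $\Gamma$ with quotient matrix $(\mu+1)I+\mu(J-I)$. Consequently, for every positive integer $j$ there exists a directed strongly regular graph with parameter set $(N,K,\Lambda+1,\Lambda,\Lambda)$, where $$N=\Big(\frac{j(k-1)}{\mu}+1\Big)\cdot\frac{k^2-1}{\mu},\quad K=\frac{j(k^2-1)}{\mu}+k,\quad \Lambda=j(k+1)+\mu.$$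
   Context: A directed strongly regular graph (DSRG) with parameters $(n,k,t,\lambda,\mu)$ is a loopless digraph on $n$ vertices whose adjacency matrix $A$ satisfies $AJ=JA=kJ$ and $A^2=tI+\lambda A+\mu(J-I-A)$. The digraph $\Gamma$ in the claim (due to Jørgensen) is known to be a DSRG with parameters $((k^2-1)/\mu,k,\mu+1,\mu,\mu)$. A partition $\{C_0,\dots,C_{a-1}\}$ is column equitable with quotient matrix $Q=(q_{i,l})$ if for all $i,l$ and every vertex $v\in C_l$ the number of arcs from vertices of $C_i$ to $v$ equals $q_{i,l}$. $I$ and $J$ are the $a\times a$ identity and all-ones matrices. -}

module Defs where

open import Data.Nat using (ℕ; zero; suc; _+_; _*_; _∸_; _≡ᵇ_; _≤ᵇ_)
open import Data.Nat.DivMod using (_%_)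
open import Data.Bool using (Bool; true; false; if_then_else_; _∧_; _∨_)
open import Data.Fin using (Fin; toℕ) renaming (zero to fzero; suc to fsuc)
import Data.Fin as F
open import Data.Product using (∃; _×_)
open import Relation.Nullary.Decidable using (⌊_⌋)
open import Relation.Binary.PropositionalEquality using (_≡_; _≢_)

-- residue of x modulo m (the case m = 0 never occurs below; it is a totalising convention)
_mod'_ : ℕ → ℕ → ℕ
x mod' zero = x
x mod' suc m = x % suc m

count : ∀ {n} → (Fin n → Bool) → ℕ
count {zero} p = 0
count {suc n} p = (if p fzero then 1 else 0) + count (λ i → p (fsuc i))

Digraph : ℕ → Set
Digraph n = Fin n → Fin n → Bool

-- number of directed 2-walks x → z → y, i.e. the (x,y) entry of A²
walks2 : ∀ {n} → Digraph n → Fin n → Fin n → ℕ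
walks2 A x y = count (λ z → A x z ∧ A z y)

-- directed strongly regular graph with parameters (n,k,t,λ,μ), n = number of vertices:
-- loopless, AJ = JA = kJ, and A² = tI + λA + μ(J - I - A) entrywise
record IsDSRG {n : ℕ} (A : Digraph n) (k t lam mu : ℕ) : Set where
  field
    loopless  : ∀ x → A x x ≡ false
    outdeg    : ∀ x → count (λ y → A x y) ≡ k
    indeg     : ∀ y → count (λ x → A x y) ≡ k
    sq-diag   : ∀ x → walks2 A x x ≡ t
    sq-arc    : ∀ x y → A x y ≡ true → walks2 A x y ≡ lam
    sq-nonarc : ∀ x y → x ≢ y → A x y ≡ false → walks2 A x y ≡ mu

record IsColumnEquitable {n : ℕ} (A : Digraph n) (a : ℕ) (C : Fin a → Fin n → Bool)
                         (q : Fin a → Fin a → ℕ) : Set where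
  field
    nonempty  : ∀ i → ∃ λ v → C i v ≡ true
    covers    : ∀ v → ∃ λ i → C i v ≡ true
    disjoint  : ∀ i i' v → C i v ≡ true → C i' v ≡ true → i ≡ i'
    equitable : ∀ i l v → C l v ≡ true → count (λ u → C i u ∧ A u v) ≡ q i l

Γ : (n k : ℕ) → Digraph n
Γ n k x y = (1 ≤ᵇ r) ∧ (r ≤ᵇ k)
  where r = (toℕ x + k * toℕ y) mod' n

anyS : ℕ → (ℕ → Bool) → Bool
anyS zero p = false
anyS (suc m) p = p (suc m) ∨ anyS m p

-- C_i = {ib} ∪ {k(s - ib) : s ∈ {1..k}} in Z_n, with b = k + 1
-- (s - ib mod n is computed as s + (n - (ib mod n)))
Cpart : (n k : ℕ) → ℕ → Fin n → Bool
Cpart n k i v =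
  (toℕ v ≡ᵇ ib) ∨ anyS k (λ s → toℕ v ≡ᵇ (k * (s + (n ∸ ib))) mod' n)
  where ib = (i * (k + 1)) mod' n

Qmat : (a mu : ℕ) → Fin a → Fin a → ℕ
Qmat a mu i l = if ⌊ i F.≟ l ⌋ then mu + 1 else mu

module Submission where

-- The hypotheses say a = a′ + 1, k = 1 + a μ and n = a b with b = k + 1 (reparametrise).  An arc
-- x → y of Γ means x + k y ≡ r (mod n) with r in the window W = {1..k}.  As k² ≡ 1 and k b ≡ b,
-- multiplication by k is an involution of ℤ_n, so x has the k out-neighbours k (s - x) and y the
-- k in-neighbours s - k y (s ∈ W).  The core is a counting lemma (hits-value): the number of
-- s ∈ W with d + k s ∈ W is μ + [d ≡ 0], by induction on d, since moving the window one step
-- changes membership only at its two ends (window-step).  Counting 2-walks x → w → y with it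
-- gives μ + [x = y], so Γ is a DSRG(n, k, μ + 1, μ, μ) (Γ-isDSRG); with μ replaced by
-- j (k + 1) + μ this gives the stated family.  C_i is the closed out-neighbourhood of i b.  As
-- ℤ_n splits into a blocks of length b and W lies in block 0, block starts are pairwise
-- non-adjacent with disjoint out-neighbourhoods; so the vertices of C_i with an arc to v ∈ C_l
-- are i b (if i b → v) and the middles of the 2-walks i b → w → v: μ + [i = l] in total.

open import Defs
open import Algebra.Properties.CommutativeSemigroup using (interchange)
open import Data.Bool using (Bool; true; false; if_then_else_; _∧_; _∨_; T)
open import Data.Bool.Properties using (⇔→≡; ∧-identityʳ; ∧-comm)
open import Data.Empty using (⊥; ⊥-elim)
open import Data.Fin using (Fin; toℕ; fromℕ<)
import Data.Fin as F
open import Data.Fin.Properties using (toℕ<n; toℕ-injective; toℕ-fromℕ<)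
open import Data.Nat using (ℕ; zero; suc; _+_; _*_; _∸_; _≤_; _<_; z≤n; s≤s; z<s; _≡ᵇ_; _≤ᵇ_)
open import Data.Nat.Divisibility using (_∣_; n∣m*n)
open import Data.Nat.DivMod
open import Data.Nat.Properties
open import Data.Nat.Tactic.RingSolver using (solve-∀)
open import Data.Product using (Σ; _×_; _,_; proj₁; proj₂)
open import Data.Sum using (_⊎_; inj₁; inj₂)
open import Data.Unit using (tt)
open import Function.Bundles using (_⇔_; mk⇔; Equivalence)
open import Function.Properties.Equivalence using (⇔-setoid)
open import Level using (0ℓ)
open import Relation.Binary.Bundles using (Setoid)
open import Relation.Binary.PropositionalEquality
import Relation.Binary.Reasoning.Setoid as SetoidReasoning
open import Relation.Nullary using (¬_; yes; no)

+-interchange : ∀ w x y z → w + x + (y + z) ≡ w + y + (x + z)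
+-interchange = interchange +-commutativeSemigroup

module ⇔-Reasoning = SetoidReasoning (⇔-setoid 0ℓ)

ind : Bool → ℕ
ind b = if b then 1 else 0

not-true : ∀ {b} → ¬ b ≡ true → b ≡ false
not-true {false} _ = refl
not-true {true} h = ⊥-elim (h refl)

∧-elim : ∀ {x y} → (x ∧ y) ≡ true → x ≡ true × y ≡ true
∧-elim {true} {true} _ = refl , refl

∨-elim : ∀ {x y} → (x ∨ y) ≡ true → x ≡ true ⊎ y ≡ true
∨-elim {true} _ = inj₁ refl
∨-elim {false} h = inj₂ h

∨-introʳ : ∀ x {y} → y ≡ true → (x ∨ y) ≡ true
∨-introʳ true _ = refl
∨-introʳ false h = h

≡ᵇ-sound : ∀ {m n} → (m ≡ᵇ n) ≡ true → m ≡ n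
≡ᵇ-sound {m} {n} p = ≡ᵇ⇒≡ m n (subst T (sym p) tt)

≡ᵇ-complete : ∀ {m n} → m ≡ n → (m ≡ᵇ n) ≡ true
≡ᵇ-complete {m} {n} p with m ≡ᵇ n | ≡⇒≡ᵇ m n p
... | true | _ = refl

≡ᵇ-false : ∀ {m n} → m ≢ n → (m ≡ᵇ n) ≡ false
≡ᵇ-false ne = not-true (λ h → ne (≡ᵇ-sound h))

≡ᵇ-⇔ : ∀ {m n} → (m ≡ᵇ n) ≡ true ⇔ m ≡ n
≡ᵇ-⇔ = mk⇔ ≡ᵇ-sound ≡ᵇ-complete

inRange : ℕ → ℕ → Bool
inRange m r = (1 ≤ᵇ r) ∧ (r ≤ᵇ m)

inRange-elim : ∀ {m r} → inRange m r ≡ true → 1 ≤ r × r ≤ m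
inRange-elim {m} {r} h with ∧-elim {1 ≤ᵇ r} h
... | p , q = ≤ᵇ⇒≤ 1 r (subst T (sym p) tt) , ≤ᵇ⇒≤ r m (subst T (sym q) tt)

inRange-intro : ∀ {m r} → 1 ≤ r → r ≤ m → inRange m r ≡ true
inRange-intro {m} {r} p q with 1 ≤ᵇ r | ≤⇒≤ᵇ p | r ≤ᵇ m | ≤⇒≤ᵇ q
... | true | _ | true | _ = refl

sumTo : ℕ → (ℕ → ℕ) → ℕ
sumTo zero g = 0
sumTo (suc m) g = g (suc m) + sumTo m g

sumTo-cong : ∀ m {g h : ℕ → ℕ} → (∀ s → 1 ≤ s → s ≤ m → g s ≡ h s) → sumTo m g ≡ sumTo m h
sumTo-cong zero p = refl
sumTo-cong (suc m) p = cong₂ _+_ (p (suc m) (s≤s z≤n) ≤-refl) (sumTo-cong m (λ s l u → p s l (m≤n⇒m≤1+n u)))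

sumTo-+ : ∀ m (g h : ℕ → ℕ) → sumTo m (λ s → g s + h s) ≡ sumTo m g + sumTo m h
sumTo-+ zero g h = refl
sumTo-+ (suc m) g h = trans (cong (g (suc m) + h (suc m) +_) (sumTo-+ m g h))
                            (+-interchange (g (suc m)) (h (suc m)) (sumTo m g) (sumTo m h))

sumTo-ones : ∀ m → sumTo m (λ _ → 1) ≡ m
sumTo-ones zero = refl
sumTo-ones (suc m) = cong suc (sumTo-ones m)

sumTo-split : ∀ p m (g : ℕ → ℕ) → sumTo (p + m) g ≡ sumTo p (λ s → g (m + s)) + sumTo m g
sumTo-split zero m g = refl
sumTo-split (suc p) m g =
  trans (cong₂ _+_ (cong g (trans (cong suc (+-comm p m)) (sym (+-suc m p)))) (sumTo-split p m g)) (sym (+-assoc (g (m + suc p)) _ _))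

sumTo-zeros : ∀ m (g : ℕ → ℕ) → (∀ s → 1 ≤ s → s ≤ m → g s ≡ 0) → sumTo m g ≡ 0
sumTo-zeros m g h = trans (sumTo-cong m h) (sumTo-zeros′ m)
  where
  sumTo-zeros′ : ∀ m → sumTo m (λ _ → 0) ≡ 0
  sumTo-zeros′ zero = refl
  sumTo-zeros′ (suc m) = sumTo-zeros′ m

inRange-suc : ∀ m r → ind (inRange m (suc r)) + ind (m ≡ᵇ r) ≡ ind (inRange (suc m) (suc r))
inRange-suc zero zero = refl
inRange-suc zero (suc r) = refl
inRange-suc (suc m) zero = refl
inRange-suc (suc m) (suc r) = inRange-suc m r

inRange-above : ∀ {m r} → m < r → inRange m r ≡ false
inRange-above {m} {r} m<r = not-true (λ h → <-irrefl refl (≤-<-trans (proj₂ (inRange-elim {m} h)) m<r))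

sumTo-point : ∀ m r → sumTo m (λ s → ind (s ≡ᵇ r)) ≡ ind (inRange m r)
sumTo-point zero zero = refl
sumTo-point zero (suc r) = refl
sumTo-point (suc m) zero = sumTo-point m zero
sumTo-point (suc m) (suc r) =
  trans (cong (ind (m ≡ᵇ r) +_) (sumTo-point m (suc r))) (trans (+-comm (ind (m ≡ᵇ r)) _) (inRange-suc m r))

-- For the window W = {1..m}:  [r + 1 ∈ W] + [r = m] = [r ∈ W] + [r = 0], i.e. moving one step to
-- the right enters W at 0 and leaves it at m.
window-step : ∀ m r → ind (inRange m (suc r)) + ind (m ≡ᵇ r) ≡ ind (inRange m r) + ind (0 ≡ᵇ r)
window-step zero zero = refl
window-step (suc m) zero = refl
window-step m (suc r) = trans (inRange-suc m (suc r)) (sym (+-identityʳ _))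

countBelow : ℕ → (ℕ → Bool) → ℕ
countBelow n P = count {n} (λ u → P (toℕ u))

countBelow-cong : ∀ n {P Q : ℕ → Bool} → (∀ w → w < n → P w ≡ Q w) → countBelow n P ≡ countBelow n Q
countBelow-cong zero h = refl
countBelow-cong (suc n) h = cong₂ _+_ (cong ind (h 0 z<s)) (countBelow-cong n (λ w p → h (suc w) (s≤s p)))

countBelow-none : ∀ n → countBelow n (λ _ → false) ≡ 0
countBelow-none zero = refl
countBelow-none (suc n) = countBelow-none n

countBelow-single : ∀ n e (P : ℕ → Bool) → e < n → countBelow n (λ w → (w ≡ᵇ e) ∧ P w) ≡ ind (P e)
countBelow-single (suc n) zero P _ = trans (cong (ind (P 0) +_) (countBelow-none n)) (+-identityʳ _)
countBelow-single (suc n) (suc e) P (s≤s p) = countBelow-single n e (λ w → P (suc w)) p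

countBelow-∨ : ∀ n (f g P : ℕ → Bool) → (∀ w → f w ≡ true → g w ≡ false) →
  countBelow n (λ w → (f w ∨ g w) ∧ P w) ≡ countBelow n (λ w → f w ∧ P w) + countBelow n (λ w → g w ∧ P w)
countBelow-∨ zero f g P h = refl
countBelow-∨ (suc n) f g P h =
  trans (cong₂ _+_ (ind-∨ (f 0) (g 0) (P 0) (h 0))
                   (countBelow-∨ n (λ w → f (suc w)) (λ w → g (suc w)) (λ w → P (suc w)) (λ w → h (suc w))))
        (+-interchange (ind (f 0 ∧ P 0)) _ _ _)
  where
  ind-∨ : ∀ x y p → (x ≡ true → y ≡ false) → ind ((x ∨ y) ∧ p) ≡ ind (x ∧ p) + ind (y ∧ p)
  ind-∨ false y p _ = refl
  ind-∨ true y false e rewrite e refl = refl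
  ind-∨ true y true e rewrite e refl = refl

anyS-witness : ∀ m (p : ℕ → Bool) → anyS m p ≡ true → Σ ℕ (λ s → 1 ≤ s × s ≤ m × p s ≡ true)
anyS-witness zero p ()
anyS-witness (suc m) p h with p (suc m) in eq
... | true = suc m , s≤s z≤n , ≤-refl , eq
... | false with anyS-witness m p h
... | s , l , u , ps = s , l , m≤n⇒m≤1+n u , ps

anyS-intro : ∀ m (p : ℕ → Bool) s → 1 ≤ s → s ≤ m → p s ≡ true → anyS m p ≡ true
anyS-intro zero p _ (s≤s z≤n) () _
anyS-intro (suc m) p s l u ps with p (suc m) in eq | m≤n⇒m<n∨m≡n u
... | true | _ = refl
... | false | inj₁ (s≤s u′) = anyS-intro m p s l u′ ps
... | false | inj₂ refl with trans (sym ps) eq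
... | ()

countBelow-image : ∀ m n (e : ℕ → ℕ) (P : ℕ → Bool) →
  (∀ s → e s < n) → (∀ s s′ → s ≤ m → s′ ≤ m → e s ≡ e s′ → s ≡ s′) →
  countBelow n (λ w → anyS m (λ s → w ≡ᵇ e s) ∧ P w) ≡ sumTo m (λ s → ind (P (e s)))
countBelow-image zero n e P _ _ = countBelow-none n
countBelow-image (suc m) n e P bound inj =
  trans (countBelow-∨ n (λ w → w ≡ᵇ e (suc m)) (λ w → anyS m (λ s → w ≡ᵇ e s)) P disjoint)
        (cong₂ _+_ (countBelow-single n (e (suc m)) P (bound (suc m)))
                   (countBelow-image m n e P bound (λ s s′ u u′ → inj s s′ (m≤n⇒m≤1+n u) (m≤n⇒m≤1+n u′))))
  where
  disjoint : ∀ w → (w ≡ᵇ e (suc m)) ≡ true → anyS m (λ s → w ≡ᵇ e s) ≡ false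
  disjoint w top = not-true λ rest →
    let (s , _ , s≤m , ws) = anyS-witness m (λ s → w ≡ᵇ e s) rest
        m+1≡s = inj (suc m) s ≤-refl (m≤n⇒m≤1+n s≤m) (trans (sym (≡ᵇ-sound {w} top)) (≡ᵇ-sound {w} ws))
    in <-irrefl refl (subst (_≤ m) (sym m+1≡s) s≤m)

module Modulo (N′ : ℕ) where

  N : ℕ
  N = suc N′

  infix 4 _≈_
  record _≈_ (x y : ℕ) : Set where
    constructor mk
    field residue-eq : x % N ≡ y % N
  open _≈_ public

  ≈-refl : ∀ {x} → x ≈ x
  ≈-refl = mk refl

  ≈-sym : ∀ {x y} → x ≈ y → y ≈ x
  ≈-sym (mk p) = mk (sym p)

  ≈-trans : ∀ {x y z} → x ≈ y → y ≈ z → x ≈ z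
  ≈-trans (mk p) (mk q) = mk (trans p q)

  ≡⇒≈ : ∀ {x y} → x ≡ y → x ≈ y
  ≡⇒≈ refl = ≈-refl

  ≈-setoid : Setoid _ _
  ≈-setoid = record
    { Carrier = ℕ ; _≈_ = _≈_
    ; isEquivalence = record { refl = ≈-refl ; sym = ≈-sym ; trans = ≈-trans } }

  module ≈-Reasoning = SetoidReasoning ≈-setoid

  +-cong : ∀ {x x′ y y′} → x ≈ x′ → y ≈ y′ → x + y ≈ x′ + y′
  +-cong {x} {x′} {y} {y′} (mk p) (mk q) = mk (begin
    (x + y) % N            ≡⟨ %-distribˡ-+ x y N ⟩
    (x % N + y % N) % N    ≡⟨ cong₂ (λ u v → (u + v) % N) p q ⟩
    (x′ % N + y′ % N) % N  ≡⟨ %-distribˡ-+ x′ y′ N ⟨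
    (x′ + y′) % N          ∎)
    where open ≡-Reasoning

  *-cong : ∀ {x x′ y y′} → x ≈ x′ → y ≈ y′ → x * y ≈ x′ * y′
  *-cong {x} {x′} {y} {y′} (mk p) (mk q) = mk (begin
    (x * y) % N              ≡⟨ %-distribˡ-* x y N ⟩
    (x % N * (y % N)) % N    ≡⟨ cong₂ (λ u v → (u * v) % N) p q ⟩
    (x′ % N * (y′ % N)) % N  ≡⟨ %-distribˡ-* x′ y′ N ⟨
    (x′ * y′) % N            ∎)
    where open ≡-Reasoning

  +-congˡ : ∀ x {y y′} → y ≈ y′ → x + y ≈ x + y′
  +-congˡ x p = +-cong (≈-refl {x}) p

  +-congʳ : ∀ {x x′} y → x ≈ x′ → x + y ≈ x′ + y
  +-congʳ y p = +-cong p (≈-refl {y})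

  *-congˡ : ∀ x {y y′} → y ≈ y′ → x * y ≈ x * y′
  *-congˡ x p = *-cong (≈-refl {x}) p

  %-≈ : ∀ x → x % N ≈ x
  %-≈ x = mk (m%n%n≡m%n x N)

  multiple-≈0 : ∀ m → m * N ≈ 0
  multiple-≈0 m = mk (m*n%n≡0 m N)

  N≈0 : N ≈ 0
  N≈0 = mk (n%n≡0 N)

  -- The additive inverse of x, as a number in [1, N].
  negate : ℕ → ℕ
  negate x = N ∸ x % N

  +-negate : ∀ x → x + negate x ≈ 0
  +-negate x = begin
    x + negate x          ≈⟨ +-congʳ (negate x) (≈-sym (%-≈ x)) ⟩
    x % N + (N ∸ x % N)   ≡⟨ m+[n∸m]≡n (m%n≤n x N) ⟩
    N                     ≈⟨ N≈0 ⟩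
    0                     ∎
    where open ≈-Reasoning

  +-solve : ∀ x z t → (x + z ≈ t) ⇔ (x ≈ t + negate z)
  +-solve x z t = mk⇔ forward backward
    where
    open ≈-Reasoning
    forward : x + z ≈ t → x ≈ t + negate z
    forward p = begin
      x                      ≡⟨ +-identityʳ x ⟨
      x + 0                  ≈⟨ +-congˡ x (+-negate z) ⟨
      x + (z + negate z)     ≡⟨ +-assoc x z _ ⟨
      x + z + negate z       ≈⟨ +-congʳ (negate z) p ⟩
      t + negate z           ∎
    backward : x ≈ t + negate z → x + z ≈ t
    backward p = begin
      x + z                  ≈⟨ +-congʳ z p ⟩
      t + negate z + z       ≡⟨ +-assoc t _ z ⟩
      t + (negate z + z)     ≡⟨ cong (t +_) (+-comm (negate z) z) ⟩
      t + (z + negate z)     ≈⟨ +-congˡ t (+-negate z) ⟩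
      t + 0                  ≡⟨ +-identityʳ t ⟩
      t                      ∎

  +-cancelʳ : ∀ {x y} z → x + z ≈ y + z → x ≈ y
  +-cancelʳ {x} {y} z p = ≈-trans (Equivalence.to (+-solve x z (y + z)) p)
                                 (≈-sym (Equivalence.to (+-solve y z (y + z)) ≈-refl))

  residue : ∀ {x y} → x ≈ y → y < N → x % N ≡ y
  residue (mk p) y<N = trans p (m<n⇒m%n≡m y<N)

  ≈-below : ∀ {x y} → x ≈ y → x < N → y < N → x ≡ y
  ≈-below p x<N y<N = trans (sym (m<n⇒m%n≡m x<N)) (residue p y<N)

  ≡ᵇ-residue : ∀ {w y} → w < N → (w ≡ᵇ y % N) ≡ true ⇔ w ≈ y
  ≡ᵇ-residue {w} {y} w<N =
    mk⇔ (λ h → ≈-trans (≡⇒≈ (≡ᵇ-sound h)) (%-≈ y))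
        (λ p → ≡ᵇ-complete (sym (residue (≈-sym p) w<N)))

  ≈-flip : ∀ {x y} → (x ≈ y) ⇔ (y ≈ x)
  ≈-flip = mk⇔ ≈-sym ≈-sym

  -- window-step also holds for the successor taken in ℤ_N, since a window {1..m} with m < N does
  -- not wrap around.
  window-step-mod : ∀ m r → m < N → r < N →
    ind (inRange m (suc r % N)) + ind (m ≡ᵇ r) ≡ ind (inRange m r) + ind (0 ≡ᵇ r)
  window-step-mod m r m<N r<N = trans (cong (λ z → ind z + ind (m ≡ᵇ r)) no-wrap) (window-step m r)
    where
    no-wrap : inRange m (suc r % N) ≡ inRange m (suc r)
    no-wrap with m≤n⇒m<n∨m≡n r<N
    ... | inj₁ 1+r<N = cong (inRange m) (m<n⇒m%n≡m 1+r<N)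
    ... | inj₂ refl = trans (cong (inRange m) (n%n≡0 N)) (sym (inRange-above m<N))

  ≈-below-⇔ : ∀ {x y} → x < N → y < N → (x ≈ y) ⇔ (x ≡ y)
  ≈-below-⇔ x<N y<N = mk⇔ (λ p → ≈-below p x<N y<N) ≡⇒≈

  inverse-unique : ∀ x y z → y + z ≈ 0 → (x + z ≈ 0) ⇔ (x ≈ y)
  inverse-unique x y z y+z≈0 =
    mk⇔ (λ p → +-cancelʳ z (≈-trans p (≈-sym y+z≈0))) (λ p → ≈-trans (+-congʳ z p) y+z≈0)

-- The setting of the theorem: a = a′ + 1, k = 1 + a μ, b = k + 1 and n = a b.  The modulus is
-- written N = (k + a′ b) + 1, which is a b by computation.
module Jorgensen (a′ μ : ℕ) where

  a : ℕ
  a = suc a′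

  K : ℕ
  K = suc (a * μ)

  b : ℕ
  b = suc K

  open Modulo (K + a′ * b) public

  K<N : K < N
  K<N = s≤s (m≤m+n K (a′ * b))

  -- k² = 1 + μ n and k(k + 1) = (k + 1) + μ n.
  K*K≈1 : K * K ≈ 1
  K*K≈1 = ≈-trans (≡⇒≈ (expand a′ μ)) (+-congˡ 1 (multiple-≈0 μ))
    where
    expand : ∀ a′ μ → suc (suc a′ * μ) * suc (suc a′ * μ) ≡ 1 + μ * (suc a′ * suc (suc (suc a′ * μ)))
    expand = solve-∀

  K*b≈b : K * b ≈ b
  K*b≈b = ≈-trans (≡⇒≈ (expand a′ μ)) (≈-trans (+-congˡ b (multiple-≈0 μ)) (≡⇒≈ (+-identityʳ b)))
    where
    expand : ∀ a′ μ → suc (suc a′ * μ) * suc (suc (suc a′ * μ)) ≡ suc (suc (suc a′ * μ)) + μ * (suc a′ * suc (suc (suc a′ * μ)))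
    expand = solve-∀

  K-involutive : ∀ x → K * (K * x) ≈ x
  K-involutive x = begin
    K * (K * x)   ≡⟨ *-assoc K K x ⟨
    K * K * x     ≈⟨ *-cong K*K≈1 (≈-refl {x}) ⟩
    1 * x         ≡⟨ *-identityˡ x ⟩
    x             ∎
    where open ≈-Reasoning

  K-solve : ∀ x t → (K * x ≈ t) ⇔ (x ≈ K * t)
  K-solve x t = mk⇔ (λ p → ≈-trans (≈-sym (K-involutive x)) (*-congˡ K p))
                    (λ p → ≈-trans (*-congˡ K p) (K-involutive t))

  K-cancel : ∀ {x y} → K * x ≈ K * y → x ≈ y
  K-cancel {x} {y} p = ≈-trans (Equivalence.to (K-solve x (K * y)) p) (K-involutive y)

  reduce-block : ∀ c t → t < b → (c * b + t) % N ≡ (c % a) * b + t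
  reduce-block c t t<b =
    trans ([m*n+o]%[p*n]≡[m*n]%[p*n]+o c a t<b) (cong (_+ t) (sym (m%n*o≡m*o%[n*o] c a b)))

  block-below : ∀ {i s} → i < a → s < b → i * b + s < N
  block-below {i} {s} i<a s<b = begin-strict
    i * b + s   <⟨ +-monoʳ-< (i * b) s<b ⟩
    i * b + b   ≡⟨ +-comm (i * b) b ⟩
    suc i * b   ≤⟨ *-monoˡ-≤ b i<a ⟩
    a * b       ∎
    where open ≤-Reasoning

  window-block : ∀ c t → t < b → inRange K ((c * b + t) % N) ≡ true → c % a ≡ 0 × 1 ≤ t
  window-block c t t<b h = in-block-zero (c % a) (subst (λ r → inRange K r ≡ true) (reduce-block c t t<b) h)
    where
    in-block-zero : ∀ q → inRange K (q * b + t) ≡ true → q ≡ 0 × 1 ≤ t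
    in-block-zero zero h = refl , proj₁ (inRange-elim h)
    in-block-zero (suc q) h =
      ⊥-elim (1+n≰n (≤-trans (≤-trans (m≤m+n b (q * b)) (m≤m+n _ t)) (proj₂ (inRange-elim h))))

  multiple-outside : ∀ c → inRange K ((c * b) % N) ≡ false
  multiple-outside c = not-true λ h →
    1+n≰n (proj₂ (window-block c 0 z<s (subst (λ r → inRange K (r % N) ≡ true) (sym (+-identityʳ (c * b))) h)))

  -- The vertex i b (i < a), written as in the definition of C_i.
  blockStart : ℕ → ℕ
  blockStart i = (i * (K + 1)) % N

  blockStart≡ : ∀ {i} → i < a → blockStart i ≡ i * b
  blockStart≡ {i} i<a =
    trans (cong (λ z → (i * z) % N) (+-comm K 1)) (m<n⇒m%n≡m (*-monoˡ-< b i<a))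

  block-unique : ∀ {i l s t} → i < a → l < a → s < b → t < b → i * b + s ≈ l * b + t → i ≡ l
  block-unique {i} {l} {s} {t} i<a l<a s<b t<b p = begin
    i                  ≡⟨ quotient i s s<b ⟨
    (i * b + s) / b    ≡⟨ cong (_/ b) (≈-below p (block-below i<a s<b) (block-below l<a t<b)) ⟩
    (l * b + t) / b    ≡⟨ quotient l t t<b ⟩
    l                  ∎
    where
    open ≡-Reasoning
    quotient : ∀ c r → r < b → (c * b + r) / b ≡ c
    quotient c r r<b = trans (+-distrib-/-∣ˡ r (n∣m*n c))
                             (trans (cong₂ _+_ (m*n/n≡m c b) (m<n⇒m/n≡0 r<b)) (+-identityʳ c))

  arc-solve : ∀ x y s → (x + K * y ≈ s) ⇔ (y ≈ K * (s + negate x))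
  arc-solve x y s = begin
    x + K * y ≈ s                ≡⟨ cong (_≈ s) (+-comm x (K * y)) ⟩
    K * y + x ≈ s                ≈⟨ +-solve (K * y) x s ⟩
    K * y ≈ s + negate x         ≈⟨ K-solve y (s + negate x) ⟩
    y ≈ K * (s + negate x)       ∎
    where open ⇔-Reasoning

  hits : ℕ → ℕ
  hits d = sumTo K (λ s → ind (inRange K ((d + K * s) % N)))

  -- s ↦ d + k s is a bijection of ℤ_n, so a residue t is hit by at most one s ∈ {1..k},
  -- namely by s = k (t - d) when this lies in {1..k}.
  hits-fibre : ∀ d t → t < N →
    sumTo K (λ s → ind (t ≡ᵇ (d + K * s) % N)) ≡ ind (inRange K ((K * (t + negate d)) % N))
  hits-fibre d t t<N = trans (sumTo-cong K (λ s _ s≤K → cong ind (⇔→≡ (same-test s s≤K)))) (sumTo-point K _)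
    where
    same-test : ∀ s → s ≤ K → (t ≡ᵇ (d + K * s) % N) ≡ true ⇔ (s ≡ᵇ (K * (t + negate d)) % N) ≡ true
    same-test s s≤K = begin
      (t ≡ᵇ (d + K * s) % N) ≡ true              ≈⟨ ≡ᵇ-residue t<N ⟩
      t ≈ d + K * s                              ≈⟨ ≈-flip ⟩
      d + K * s ≈ t                              ≈⟨ arc-solve d s t ⟩
      s ≈ K * (t + negate d)                     ≈⟨ ≡ᵇ-residue (≤-<-trans s≤K K<N) ⟨
      (s ≡ᵇ (K * (t + negate d)) % N) ≡ true     ∎
      where open ⇔-Reasoning

  -- Residue of -k d; the window membership of it and of its successor governs hits (d + 1) - hits d.
  opposite : ℕ → ℕ
  opposite d = (K * (0 + negate d)) % N

  opposite-suc : ∀ d → (K * (K + negate d)) % N ≡ suc (opposite d) % N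
  opposite-suc d = residue-eq (begin
    K * (K + negate d)           ≡⟨ *-distribˡ-+ K K (negate d) ⟩
    K * K + K * negate d         ≈⟨ +-cong K*K≈1 (≈-sym (%-≈ (K * negate d))) ⟩
    suc (opposite d)             ∎)
    where open ≈-Reasoning

  -- Summing window-step-mod over the residues d + k s: the boundary counts are the numbers of
  -- s ∈ {1..k} with d + k s ≡ k resp. 0, i.e. the window memberships of k(k - d) and -k d.
  hits-step : ∀ d → hits (suc d) + ind (inRange K (suc (opposite d) % N)) ≡ hits d + ind (inRange K (opposite d))
  hits-step d = begin
    hits (suc d) + ind (inRange K (suc (opposite d) % N))
      ≡⟨ cong (λ r → hits (suc d) + ind (inRange K r)) (opposite-suc d) ⟨
    hits (suc d) + ind (inRange K ((K * (K + negate d)) % N))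
      ≡⟨ cong (hits (suc d) +_) (hits-fibre d K K<N) ⟨
    hits (suc d) + sumTo K (λ s → ind (K ≡ᵇ r s))
      ≡⟨ sumTo-+ K (λ s → ind (inRange K (suc (d + K * s) % N))) (λ s → ind (K ≡ᵇ r s)) ⟨
    sumTo K (λ s → ind (inRange K (suc (d + K * s) % N)) + ind (K ≡ᵇ r s))
      ≡⟨ sumTo-cong K (λ s _ _ → shift s) ⟩
    sumTo K (λ s → ind (inRange K (r s)) + ind (0 ≡ᵇ r s))
      ≡⟨ sumTo-+ K (λ s → ind (inRange K (r s))) (λ s → ind (0 ≡ᵇ r s)) ⟩
    hits d + sumTo K (λ s → ind (0 ≡ᵇ r s))
      ≡⟨ cong (hits d +_) (hits-fibre d 0 z<s) ⟩
    hits d + ind (inRange K (opposite d))  ∎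
    where
    open ≡-Reasoning
    r : ℕ → ℕ
    r s = (d + K * s) % N
    shift : ∀ s → ind (inRange K (suc (d + K * s) % N)) + ind (K ≡ᵇ r s) ≡ ind (inRange K (r s)) + ind (0 ≡ᵇ r s)
    shift s = trans (cong (λ z → ind (inRange K z) + ind (K ≡ᵇ r s)) (residue-eq (+-congˡ 1 (≈-sym (%-≈ (d + K * s))))))
                    (window-step-mod K (r s) K<N (m%n<n (d + K * s) N))

  opposite-test : ∀ d y → y < N → (y ≡ᵇ opposite d) ≡ (0 ≡ᵇ (d + K * y) % N)
  opposite-test d y y<N = ⇔→≡ (begin
    (y ≡ᵇ opposite d) ≡ true            ≈⟨ ≡ᵇ-residue y<N ⟩
    y ≈ K * (0 + negate d)              ≈⟨ arc-solve d y 0 ⟨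
    d + K * y ≈ 0                       ≈⟨ ≈-flip ⟩
    0 ≈ d + K * y                       ≈⟨ ≡ᵇ-residue z<s ⟨
    (0 ≡ᵇ (d + K * y) % N) ≡ true       ∎)
    where open ⇔-Reasoning

  opposite≡K : ∀ d → (K ≡ᵇ opposite d) ≡ (0 ≡ᵇ suc d % N)
  opposite≡K d = trans (opposite-test d K K<N)
    (cong (0 ≡ᵇ_) (residue-eq (≈-trans (+-congˡ d K*K≈1) (≡⇒≈ (+-comm d 1)))))

  opposite≡0 : ∀ d → (0 ≡ᵇ opposite d) ≡ (0 ≡ᵇ d % N)
  opposite≡0 d = trans (opposite-test d 0 z<s) (cong (λ z → 0 ≡ᵇ z % N) (trans (cong (d +_) (*-zeroʳ K)) (+-identityʳ d)))

  -- k (t + 1) = t b + (k - t), so for t < k the residue k (t + 1) lies in the window iff a ∣ t.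
  window-multiple : ∀ t → t < K → inRange K ((0 + K * suc t) % N) ≡ (t % a ≡ᵇ 0)
  window-multiple t t<K = trans (cong (λ z → inRange K (z % N)) split) (⇔→≡ (mk⇔ aligned inside))
    where
    split : K * suc t ≡ t * b + (K ∸ t)
    split = +-cancelʳ-≡ t _ _ (begin
      K * suc t + t          ≡⟨ expand K t ⟩
      t * b + K              ≡⟨ cong (t * b +_) (m∸n+n≡m (<⇒≤ t<K)) ⟨
      t * b + (K ∸ t + t)    ≡⟨ +-assoc (t * b) (K ∸ t) t ⟨
      t * b + (K ∸ t) + t    ∎)
      where
      open ≡-Reasoning
      expand : ∀ K t → K * suc t + t ≡ t * suc K + K
      expand = solve-∀
    offset<b : K ∸ t < b
    offset<b = s≤s (m∸n≤m K t)
    aligned : inRange K ((t * b + (K ∸ t)) % N) ≡ true → (t % a ≡ᵇ 0) ≡ true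
    aligned h = ≡ᵇ-complete (proj₁ (window-block t (K ∸ t) offset<b h))
    inside : (t % a ≡ᵇ 0) ≡ true → inRange K ((t * b + (K ∸ t)) % N) ≡ true
    inside h = subst (λ r → inRange K r ≡ true)
      (sym (trans (reduce-block t (K ∸ t) offset<b) (cong (λ q → q * b + (K ∸ t)) (≡ᵇ-sound {t % a} h))))
      (inRange-intro (m<n⇒0<n∸m t<K) (m∸n≤m K t))

  count-aligned : ∀ M → sumTo (suc (M * a)) (λ s → ind ((s ∸ 1) % a ≡ᵇ 0)) ≡ suc M
  count-aligned zero = refl
  count-aligned (suc M) = begin
    sumTo (suc (a + M * a)) aligned                          ≡⟨ cong (λ m → sumTo m aligned) (+-suc a (M * a)) ⟨
    sumTo (a + suc (M * a)) aligned                          ≡⟨ sumTo-split a (suc (M * a)) aligned ⟩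
    sumTo a (λ s → aligned (suc (M * a) + s)) + sumTo (suc (M * a)) aligned
                                                             ≡⟨ cong₂ _+_ (cong₂ _+_ last others) (count-aligned M) ⟩
    suc (suc M)                                              ∎
    where
    open ≡-Reasoning
    aligned : ℕ → ℕ
    aligned s = ind ((s ∸ 1) % a ≡ᵇ 0)
    last : aligned (suc (M * a) + a) ≡ 1
    last = cong (λ z → ind (z ≡ᵇ 0)) (trans (cong (_% a) (+-comm (M * a) a)) (m*n%n≡0 (suc M) a))
    others : sumTo a′ (λ s → aligned (suc (M * a) + s)) ≡ 0
    others = sumTo-zeros a′ _ λ s 1≤s s≤a′ → cong ind (≡ᵇ-false (λ r≡0 →
      1+n≰n (≤-trans 1≤s (≤-reflexive (trans (sym (offset s s≤a′)) r≡0)))))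
      where
      offset : ∀ s → s ≤ a′ → (M * a + s) % a ≡ s
      offset s s≤a′ = trans (cong (_% a) (+-comm (M * a) s)) (trans ([m+kn]%n≡m%n s M a) (m<n⇒m%n≡m (s≤s s≤a′)))

  -- By window-multiple, the s ∈ {1..k} hitting the window for d = 0 are those with a ∣ s - 1.
  hits-zero : hits 0 ≡ μ + 1
  hits-zero = begin
    hits 0                                                ≡⟨ sumTo-cong K (λ { (suc t) _ s≤K → cong ind (window-multiple t s≤K) }) ⟩
    sumTo K (λ s → ind ((s ∸ 1) % a ≡ᵇ 0))               ≡⟨ cong (λ m → sumTo (suc m) (λ s → ind ((s ∸ 1) % a ≡ᵇ 0))) (*-comm a μ) ⟩
    sumTo (suc (μ * a)) (λ s → ind ((s ∸ 1) % a ≡ᵇ 0))   ≡⟨ count-aligned μ ⟩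
    suc μ                                                 ≡⟨ +-comm 1 μ ⟩
    μ + 1                                                 ∎
    where open ≡-Reasoning

  -- Key counting lemma: hits d = μ + [d ≡ 0 (mod n)].
  -- Induction on d: hits-step and window-step-mod (at the residue -k d) have the same boundary terms.
  hits-value : ∀ d → hits d ≡ μ + ind (0 ≡ᵇ d % N)
  hits-value zero = hits-zero
  hits-value (suc d) = +-cancelʳ-≡ next _ _ (begin
    hits (suc d) + next                    ≡⟨ hits-step d ⟩
    hits d + here                          ≡⟨ cong (_+ here) (hits-value d) ⟩
    μ + ind (0 ≡ᵇ d % N) + here            ≡⟨ +-assoc μ _ here ⟩
    μ + (ind (0 ≡ᵇ d % N) + here)          ≡⟨ cong (μ +_) (+-comm _ here) ⟩
    μ + (here + ind (0 ≡ᵇ d % N))          ≡⟨ cong (λ z → μ + (here + ind z)) (opposite≡0 d) ⟨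
    μ + (here + ind (0 ≡ᵇ opposite d))     ≡⟨ cong (μ +_) (window-step-mod K (opposite d) K<N (m%n<n (K * negate d) N)) ⟨
    μ + (next + ind (K ≡ᵇ opposite d))     ≡⟨ cong (λ z → μ + (next + ind z)) (opposite≡K d) ⟩
    μ + (next + ind (0 ≡ᵇ suc d % N))      ≡⟨ cong (μ +_) (+-comm next _) ⟩
    μ + (ind (0 ≡ᵇ suc d % N) + next)      ≡⟨ +-assoc μ _ next ⟨
    μ + ind (0 ≡ᵇ suc d % N) + next        ∎)
    where
    open ≡-Reasoning
    here next : ℕ
    here = ind (inRange K (opposite d))
    next = ind (inRange K (suc (opposite d) % N))

  arc : ℕ → ℕ → Bool
  arc x y = inRange K ((x + K * y) % N)

  window-cong : ∀ {x y} → x ≈ y → inRange K (x % N) ≡ inRange K (y % N)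
  window-cong p = cong (inRange K) (residue-eq p)

  -- x → x would need x b = x + k x in the window.
  arc-irreflexive : ∀ x → arc x x ≡ false
  arc-irreflexive x = trans (cong (λ z → inRange K (z % N)) (expand x K)) (multiple-outside x)
    where
    expand : ∀ x K → x + K * x ≡ x * suc K
    expand = solve-∀

  window-preimage : ∀ {w} g (e : ℕ → ℕ) → w < N → (∀ s → (g ≈ s) ⇔ (w ≈ e s)) →
    inRange K (g % N) ≡ anyS K (λ s → w ≡ᵇ e s % N)
  window-preimage {w} g e w<N solve = ⇔→≡ (mk⇔ forward backward)
    where
    forward : inRange K (g % N) ≡ true → anyS K (λ s → w ≡ᵇ e s % N) ≡ true
    forward h with inRange-elim h
    ... | 1≤r , r≤K = anyS-intro K (λ s → w ≡ᵇ e s % N) (g % N) 1≤r r≤K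
      (Equivalence.from (≡ᵇ-residue w<N) (Equivalence.to (solve (g % N)) (≈-sym (%-≈ g))))
    backward : anyS K (λ s → w ≡ᵇ e s % N) ≡ true → inRange K (g % N) ≡ true
    backward h with anyS-witness K (λ s → w ≡ᵇ e s % N) h
    ... | s , 1≤s , s≤K , ws = subst (λ r → inRange K r ≡ true)
      (sym (residue (Equivalence.from (solve s) (Equivalence.to (≡ᵇ-residue w<N) ws)) (≤-<-trans s≤K K<N)))
      (inRange-intro 1≤s s≤K)

  out-nbr : ℕ → ℕ → ℕ
  out-nbr x s = (K * (s + negate x)) % N

  in-nbr : ℕ → ℕ → ℕ
  in-nbr y s = (s + negate (K * y)) % N

  out-arc : ∀ x {w} → w < N → arc x w ≡ anyS K (λ s → w ≡ᵇ out-nbr x s)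
  out-arc x {w} w<N = window-preimage (x + K * w) (λ s → K * (s + negate x)) w<N (arc-solve x w)

  in-arc : ∀ y {w} → w < N → arc w y ≡ anyS K (λ s → w ≡ᵇ in-nbr y s)
  in-arc y {w} w<N = window-preimage (w + K * y) (λ s → s + negate (K * y)) w<N (+-solve w (K * y))

  out-nbr-injective : ∀ x s s′ → s ≤ K → s′ ≤ K → out-nbr x s ≡ out-nbr x s′ → s ≡ s′
  out-nbr-injective x s s′ s≤K s′≤K p =
    ≈-below (+-cancelʳ (negate x) (K-cancel (mk p))) (≤-<-trans s≤K K<N) (≤-<-trans s′≤K K<N)

  in-nbr-injective : ∀ y s s′ → s ≤ K → s′ ≤ K → in-nbr y s ≡ in-nbr y s′ → s ≡ s′
  in-nbr-injective y s s′ s≤K s′≤K p =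
    ≈-below (+-cancelʳ (negate (K * y)) (mk p)) (≤-<-trans s≤K K<N) (≤-<-trans s′≤K K<N)

  count-out-nbrs : ∀ x (P : ℕ → Bool) →
    countBelow N (λ w → anyS K (λ s → w ≡ᵇ out-nbr x s) ∧ P w) ≡ sumTo K (λ s → ind (P (out-nbr x s)))
  count-out-nbrs x P = countBelow-image K N (out-nbr x) P (λ s → m%n<n (K * (s + negate x)) N) (out-nbr-injective x)

  count-in-nbrs : ∀ y (P : ℕ → Bool) →
    countBelow N (λ w → anyS K (λ s → w ≡ᵇ in-nbr y s) ∧ P w) ≡ sumTo K (λ s → ind (P (in-nbr y s)))
  count-in-nbrs y P = countBelow-image K N (in-nbr y) P (λ s → m%n<n (s + negate (K * y)) N) (in-nbr-injective y)

  out-degree : ∀ x → countBelow N (arc x) ≡ K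
  out-degree x = begin
    countBelow N (arc x)                                         ≡⟨ countBelow-cong N (λ w w<N → trans (out-arc x w<N) (sym (∧-identityʳ _))) ⟩
    countBelow N (λ w → anyS K (λ s → w ≡ᵇ out-nbr x s) ∧ true) ≡⟨ count-out-nbrs x (λ _ → true) ⟩
    sumTo K (λ _ → 1)                                            ≡⟨ sumTo-ones K ⟩
    K                                                            ∎
    where open ≡-Reasoning

  in-degree : ∀ y → countBelow N (λ w → arc w y) ≡ K
  in-degree y = begin
    countBelow N (λ w → arc w y)                                 ≡⟨ countBelow-cong N (λ w w<N → trans (in-arc y w<N) (sym (∧-identityʳ _))) ⟩
    countBelow N (λ w → anyS K (λ s → w ≡ᵇ in-nbr y s) ∧ true)  ≡⟨ count-in-nbrs y (λ _ → true) ⟩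
    sumTo K (λ _ → 1)                                            ≡⟨ sumTo-ones K ⟩
    K                                                            ∎
    where open ≡-Reasoning

  walks : ℕ → ℕ → ℕ
  walks x y = countBelow N (λ w → arc x w ∧ arc w y)

  walk-offset-zero : ∀ {x y} → x < N → y < N → (0 ≡ᵇ (x + K * negate (K * y)) % N) ≡ (x ≡ᵇ y)
  walk-offset-zero {x} {y} x<N y<N = ⇔→≡ (begin
    (0 ≡ᵇ (x + K * c) % N) ≡ true    ≈⟨ ≡ᵇ-residue z<s ⟩
    0 ≈ x + K * c                    ≈⟨ ≈-flip ⟩
    x + K * c ≈ 0                    ≈⟨ inverse-unique x y (K * c) y+Kc≈0 ⟩
    x ≈ y                            ≈⟨ ≈-below-⇔ x<N y<N ⟩
    x ≡ y                            ≈⟨ ≡ᵇ-⇔ ⟨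
    (x ≡ᵇ y) ≡ true                  ∎)
    where
    open ⇔-Reasoning
    c : ℕ
    c = negate (K * y)
    y+Kc≈0 : y + K * c ≈ 0
    y+Kc≈0 = ≈-trans (+-congʳ (K * c) (≈-sym (K-involutive y)))
               (≈-trans (≡⇒≈ (sym (*-distribˡ-+ K (K * y) c)))
                 (≈-trans (*-congˡ K (+-negate (K * y))) (≡⇒≈ (*-zeroʳ K))))

  -- A 2-walk x → w → y is an in-neighbour w = s - k y of y with x + k w ≡ (x - k² y) + k s
  -- in the window, so walks x y = hits (x - k² y) = μ + [x = y].
  walks-value : ∀ {x y} → x < N → y < N → walks x y ≡ μ + ind (x ≡ᵇ y)
  walks-value {x} {y} x<N y<N = begin
    walks x y
      ≡⟨ countBelow-cong N (λ w w<N → trans (cong (arc x w ∧_) (in-arc y w<N)) (∧-comm (arc x w) _)) ⟩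
    countBelow N (λ w → anyS K (λ s → w ≡ᵇ in-nbr y s) ∧ arc x w)
      ≡⟨ count-in-nbrs y (arc x) ⟩
    sumTo K (λ s → ind (arc x (in-nbr y s)))
      ≡⟨ sumTo-cong K (λ s _ _ → cong ind (window-cong (regroup s))) ⟩
    hits (x + K * c)
      ≡⟨ hits-value (x + K * c) ⟩
    μ + ind (0 ≡ᵇ (x + K * c) % N)
      ≡⟨ cong (λ z → μ + ind z) (walk-offset-zero x<N y<N) ⟩
    μ + ind (x ≡ᵇ y)  ∎
    where
    open ≡-Reasoning
    c : ℕ
    c = negate (K * y)
    regroup : ∀ s → x + K * in-nbr y s ≈ x + K * c + K * s
    regroup s = ≈-trans (+-congˡ x (*-congˡ K (%-≈ (s + c)))) (≡⇒≈ (expand x K s c))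
      where
      expand : ∀ x K s c → x + K * (s + c) ≡ x + K * c + K * s
      expand = solve-∀

  Γ-isDSRG : IsDSRG (Γ N K) K (μ + 1) μ μ
  Γ-isDSRG = record
    { loopless  = λ x → arc-irreflexive (toℕ x)
    ; outdeg    = λ x → out-degree (toℕ x)
    ; indeg     = λ y → in-degree (toℕ y)
    ; sq-diag   = λ x → trans (walks-value (toℕ<n x) (toℕ<n x)) (cong (λ z → μ + ind z) (≡ᵇ-complete {toℕ x} refl))
    ; sq-arc    = λ x y xy → walks-distinct x y (λ { refl → distinct-ends x xy })
    ; sq-nonarc = λ x y x≢y _ → walks-distinct x y x≢y
    }
    where
    walks-distinct : ∀ x y → x ≢ y → walks (toℕ x) (toℕ y) ≡ μ
    walks-distinct x y x≢y = trans (walks-value (toℕ<n x) (toℕ<n y))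
      (trans (cong (λ z → μ + ind z) (≡ᵇ-false (λ e → x≢y (toℕ-injective e)))) (+-identityʳ μ))
    distinct-ends : ∀ x → arc (toℕ x) (toℕ x) ≡ true → ⊥
    distinct-ends x h with trans (sym h) (arc-irreflexive (toℕ x))
    ... | ()

  -- The class C_i of the partition as a predicate on residues (Cpart N K i v ≡ C i (toℕ v)).
  C : ℕ → ℕ → Bool
  C i w = (w ≡ᵇ blockStart i) ∨ anyS K (λ s → w ≡ᵇ out-nbr (i * (K + 1)) s)

  C-closed-nbhd : ∀ i {w} → w < N → C i w ≡ ((w ≡ᵇ blockStart i) ∨ arc (blockStart i) w)
  C-closed-nbhd i {w} w<N =
    cong ((w ≡ᵇ blockStart i) ∨_) (trans (sym (out-arc (i * (K + 1)) w<N)) (window-cong (+-congʳ (K * w) (≈-sym (%-≈ (i * (K + 1)))))))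

  K*block : ∀ l → K * (l * b) ≈ l * b
  K*block l = ≈-trans (≡⇒≈ (expand K l b)) (*-congˡ l K*b≈b)
    where
    expand : ∀ K l b → K * (l * b) ≡ l * (K * b)
    expand = solve-∀

  -- There are no arcs between block starts: i b + k l b ≡ (i + l) b is outside the window.
  no-arc-between-starts : ∀ {i l} → i < a → l < a → arc (blockStart i) (blockStart l) ≡ false
  no-arc-between-starts {i} {l} i<a l<a = begin
    arc (blockStart i) (blockStart l)       ≡⟨ cong₂ (λ x y → inRange K ((x + K * y) % N)) (blockStart≡ i<a) (blockStart≡ l<a) ⟩
    inRange K ((i * b + K * (l * b)) % N)   ≡⟨ window-cong (+-congˡ (i * b) (K*block l)) ⟩
    inRange K ((i * b + l * b) % N)         ≡⟨ cong (λ z → inRange K (z % N)) (*-distribʳ-+ b i l) ⟨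
    inRange K (((i + l) * b) % N)           ≡⟨ multiple-outside (i + l) ⟩
    false                                   ∎
    where open ≡-Reasoning

  -- Distinct block starts have no common out-neighbour:
  -- i b + k v ≡ r and l b + k v ≡ r′ with r, r′ in the window give i b + r′ ≡ l b + r.
  common-out-nbr : ∀ {i l v} → i < a → l < a →
    arc (blockStart i) v ≡ true → arc (blockStart l) v ≡ true → i ≡ l
  common-out-nbr {i} {l} {v} i<a l<a hi hl =
    block-unique i<a l<a (s≤s (proj₂ (inRange-elim hl))) (s≤s (proj₂ (inRange-elim hi))) (+-cancelʳ (K * v) (begin
      i * b + r′ + K * v        ≡⟨ +-comm-middle (i * b) r′ (K * v) ⟩
      i * b + K * v + r′        ≡⟨ cong (λ z → z + K * v + r′) (blockStart≡ i<a) ⟨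
      blockStart i + K * v + r′ ≈⟨ +-congʳ r′ (≈-sym (%-≈ (blockStart i + K * v))) ⟩
      r + r′                    ≡⟨ +-comm r r′ ⟩
      r′ + r                    ≈⟨ +-congʳ r (%-≈ (blockStart l + K * v)) ⟩
      blockStart l + K * v + r  ≡⟨ cong (λ z → z + K * v + r) (blockStart≡ l<a) ⟩
      l * b + K * v + r         ≡⟨ +-comm-middle (l * b) r (K * v) ⟨
      l * b + r + K * v         ∎))
    where
    open ≈-Reasoning
    r r′ : ℕ
    r = (blockStart i + K * v) % N
    r′ = (blockStart l + K * v) % N
    +-comm-middle : ∀ x y z → x + y + z ≡ x + z + y
    +-comm-middle = solve-∀

  blockStart-injective : ∀ {i l} → i < a → l < a → blockStart i ≡ blockStart l → i ≡ l
  blockStart-injective {i} {l} i<a l<a p = *-cancelʳ-≡ i l b (trans (sym (blockStart≡ i<a)) (trans p (blockStart≡ l<a)))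

  C-separation : ∀ {i l v} → i < a → l < a → C l v ≡ true → v < N →
    ind (arc (blockStart i) v) + ind (blockStart i ≡ᵇ v) ≡ ind (i ≡ᵇ l)
  C-separation {i} {l} {v} i<a l<a v∈C v<N with ∨-elim (trans (sym (C-closed-nbhd l v<N)) v∈C)
  ... | inj₁ v≡start = begin
    ind (arc (blockStart i) v) + ind (blockStart i ≡ᵇ v)
      ≡⟨ cong (λ z → ind (arc (blockStart i) z) + ind (blockStart i ≡ᵇ z)) (≡ᵇ-sound v≡start) ⟩
    ind (arc (blockStart i) (blockStart l)) + ind (blockStart i ≡ᵇ blockStart l)
      ≡⟨ cong₂ (λ x y → ind x + ind y) (no-arc-between-starts i<a l<a)
               (⇔→≡ (mk⇔ (λ h → ≡ᵇ-complete (blockStart-injective i<a l<a (≡ᵇ-sound h)))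
                         (λ h → ≡ᵇ-complete (cong blockStart (≡ᵇ-sound {i} h))))) ⟩
    ind (i ≡ᵇ l)  ∎
    where open ≡-Reasoning
  ... | inj₂ l→v = begin
    ind (arc (blockStart i) v) + ind (blockStart i ≡ᵇ v)
      ≡⟨ cong₂ (λ x y → ind x + ind y) (⇔→≡ (mk⇔ (λ i→v → ≡ᵇ-complete (common-out-nbr i<a l<a i→v l→v))
                                                  (λ i≡l → subst (λ j → arc (blockStart j) v ≡ true) (sym (≡ᵇ-sound {i} i≡l)) l→v)))
                                       (≡ᵇ-false start≢v) ⟩
    ind (i ≡ᵇ l) + 0  ≡⟨ +-identityʳ _ ⟩
    ind (i ≡ᵇ l)  ∎
    where
    open ≡-Reasoning
    start≢v : blockStart i ≢ v
    start≢v refl with trans (sym l→v) (no-arc-between-starts l<a i<a)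
    ... | ()

  block-opposite : ∀ q → q < a → Σ ℕ (λ i → i < a × blockStart i + q * b ≈ 0)
  block-opposite zero _ = 0 , s≤s z≤n , ≈-refl
  block-opposite (suc q) q<a = a ∸ suc q , i<a , ≈-trans (≡⇒≈ sum≡N) N≈0
    where
    i<a : a ∸ suc q < a
    i<a = s≤s (m∸n≤m a′ q)
    sum≡N : blockStart (a ∸ suc q) + suc q * b ≡ N
    sum≡N = begin
      blockStart (a ∸ suc q) + suc q * b  ≡⟨ cong (_+ suc q * b) (blockStart≡ i<a) ⟩
      (a ∸ suc q) * b + suc q * b         ≡⟨ *-distribʳ-+ b (a ∸ suc q) (suc q) ⟨
      (a ∸ suc q + suc q) * b             ≡⟨ cong (_* b) (m∸n+n≡m (<⇒≤ q<a)) ⟩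
      N                                   ∎
      where open ≡-Reasoning

  -- Every residue w lies in some C_i: write k w = q b + r with r < b; if r = 0 then w ≡ q b,
  -- otherwise the block start i b ≡ -(q b) satisfies i b + k w ≡ r.
  C-covers : ∀ w → w < N → Σ ℕ (λ i → i < a × C i w ≡ true)
  C-covers w w<N = cover (c % b) refl
    where
    c q : ℕ
    c = (K * w) % N
    q = c / b
    q<a : q < a
    q<a = m<n*o⇒m/o<n {c} {a} {b} (m%n<n (K * w) N)
    w≈Kc : w ≈ K * c
    w≈Kc = ≈-trans (≈-sym (K-involutive w)) (*-congˡ K (≈-sym (%-≈ (K * w))))
    c≡ : c ≡ c % b + q * b
    c≡ = m≡m%n+[m/n]*n c b
    cover : ∀ r → r ≡ c % b → Σ ℕ (λ i → i < a × C i w ≡ true)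
    cover zero r≡ = q , q<a , cong (_∨ anyS K (λ s → w ≡ᵇ out-nbr (q * (K + 1)) s)) (≡ᵇ-complete (≈-below w≈start w<N (m%n<n (q * (K + 1)) N)))
      where
      open ≈-Reasoning
      w≈start : w ≈ blockStart q
      w≈start = begin
        w              ≈⟨ w≈Kc ⟩
        K * c          ≡⟨ cong (K *_) (trans c≡ (cong (_+ q * b) (sym r≡))) ⟩
        K * (q * b)    ≈⟨ K*block q ⟩
        q * b          ≡⟨ blockStart≡ q<a ⟨
        blockStart q   ∎
    cover (suc r) r≡ with block-opposite q q<a
    ... | i , i<a , opp = i , i<a , trans (C-closed-nbhd i w<N) (∨-introʳ _ i→w)
      where
      r≤K : suc r ≤ K
      r≤K = ≤-pred (subst (_< b) (sym r≡) (m%n<n c b))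
      i→w : arc (blockStart i) w ≡ true
      i→w = subst (λ z → inRange K z ≡ true) (sym (residue lands (≤-<-trans r≤K K<N))) (inRange-intro (s≤s z≤n) r≤K)
        where
        open ≈-Reasoning
        lands : blockStart i + K * w ≈ suc r
        lands = begin
          blockStart i + K * w                ≈⟨ +-congˡ (blockStart i) (≈-sym (%-≈ (K * w))) ⟩
          blockStart i + c                    ≡⟨ cong (blockStart i +_) (trans c≡ (cong (_+ q * b) (sym r≡))) ⟩
          blockStart i + (suc r + q * b)      ≡⟨ +-comm-middle (blockStart i) (suc r) (q * b) ⟩
          blockStart i + q * b + suc r        ≈⟨ +-congʳ (suc r) opp ⟩
          suc r                               ∎
          where
          +-comm-middle : ∀ x y z → x + (y + z) ≡ x + z + y
          +-comm-middle = solve-∀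

  -- Column equitability: the in-neighbours of v ∈ C_l inside C_i are the start i b (if i b → v)
  -- and the middle vertices of the 2-walks i b → w → v, hence μ + [i = l] of them.
  C-inflow : ∀ {i l v} → i < a → l < a → v < N → C l v ≡ true →
    countBelow N (λ w → C i w ∧ arc w v) ≡ μ + ind (i ≡ᵇ l)
  C-inflow {i} {l} {v} i<a l<a v<N v∈C = begin
    countBelow N (λ w → C i w ∧ arc w v)
      ≡⟨ countBelow-cong N (λ w w<N → cong (_∧ arc w v) (C-closed-nbhd i w<N)) ⟩
    countBelow N (λ w → ((w ≡ᵇ x) ∨ arc x w) ∧ arc w v)
      ≡⟨ countBelow-∨ N (λ w → w ≡ᵇ x) (arc x) (λ w → arc w v) no-loop ⟩
    countBelow N (λ w → (w ≡ᵇ x) ∧ arc w v) + walks x v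
      ≡⟨ cong₂ _+_ (countBelow-single N x (λ w → arc w v) x<N) (walks-value x<N v<N) ⟩
    ind (arc x v) + (μ + ind (x ≡ᵇ v))
      ≡⟨ +-comm-left (ind (arc x v)) μ _ ⟩
    μ + (ind (arc x v) + ind (x ≡ᵇ v))
      ≡⟨ cong (μ +_) (C-separation i<a l<a v∈C v<N) ⟩
    μ + ind (i ≡ᵇ l)  ∎
    where
    open ≡-Reasoning
    x : ℕ
    x = blockStart i
    x<N : x < N
    x<N = m%n<n (i * (K + 1)) N
    no-loop : ∀ w → (w ≡ᵇ x) ≡ true → arc x w ≡ false
    no-loop w h = subst (λ z → arc x z ≡ false) (sym (≡ᵇ-sound h)) (arc-irreflexive x)
    +-comm-left : ∀ p q r → p + (q + r) ≡ q + (p + r)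
    +-comm-left = solve-∀

  C-isColumnEquitable : IsColumnEquitable (Γ N K) a (λ i → Cpart N K (toℕ i)) (Qmat a μ)
  C-isColumnEquitable = record
    { nonempty  = λ i → start i , cong (_∨ anyS K (λ s → toℕ (start i) ≡ᵇ out-nbr (toℕ i * (K + 1)) s)) (≡ᵇ-complete (toℕ-fromℕ< (start<N i)))
    ; covers    = covers
    ; disjoint  = λ i i′ v v∈Ci v∈Ci′ → toℕ-injective (disjoint {i} {i′} {v} v∈Ci v∈Ci′)
    ; equitable = λ i l v v∈Cl →
        trans (C-inflow (toℕ<n i) (toℕ<n l) (toℕ<n v) v∈Cl) (quotient-entry i l)
    }
    where
    start<N : (i : Fin a) → blockStart (toℕ i) < N
    start<N i = m%n<n (toℕ i * (K + 1)) N
    start : Fin a → Fin N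
    start i = fromℕ< (start<N i)
    covers : ∀ v → Σ (Fin a) (λ i → Cpart N K (toℕ i) v ≡ true)
    covers v with C-covers (toℕ v) (toℕ<n v)
    ... | i , i<a , v∈C = fromℕ< i<a , subst (λ j → C j (toℕ v) ≡ true) (sym (toℕ-fromℕ< i<a)) v∈C
    -- By C-separation, [i b → v] + [i b = v] for v ∈ C_i ∩ C_l equals both [i = l] and [i = i] = 1.
    disjoint : ∀ {i l} {v : Fin N} → Cpart N K (toℕ i) v ≡ true → Cpart N K (toℕ l) v ≡ true → toℕ i ≡ toℕ l
    disjoint {i} {l} {v} v∈Ci v∈Cl = ≡ᵇ-sound (ind-injective (trans (sym (C-separation (toℕ<n i) (toℕ<n l) v∈Cl (toℕ<n v)))
      (trans (C-separation (toℕ<n i) (toℕ<n i) v∈Ci (toℕ<n v)) (cong ind (≡ᵇ-complete {toℕ i} refl)))))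
      where
      ind-injective : ∀ {p} → ind p ≡ 1 → p ≡ true
      ind-injective {true} _ = refl
    quotient-entry : ∀ i l → μ + ind (toℕ i ≡ᵇ toℕ l) ≡ Qmat a μ i l
    quotient-entry i l with i F.≟ l
    ... | yes refl = cong (λ z → μ + ind z) (≡ᵇ-complete {toℕ i} refl)
    ... | no i≢l = trans (cong (λ z → μ + ind z) (≡ᵇ-false (λ e → i≢l (toℕ-injective e)))) (+-identityʳ μ)

jorgensen-parametrised : ∀ a′ mu → let open Jorgensen a′ mu in
  IsColumnEquitable (Γ N K) a (λ i → Cpart N K (toℕ i)) (Qmat a mu)
  × ((j : ℕ) → 1 ≤ j
     → Σ (Digraph ((j * a + 1) * N)) (λ A →
         IsDSRG A (j * N + K) (j * (K + 1) + mu + 1) (j * (K + 1) + mu) (j * (K + 1) + mu)))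
jorgensen-parametrised a′ mu = C-isColumnEquitable , family
  where
  open Jorgensen a′ mu
  -- Jørgensen's theorem for μ′ = j (k + 1) + μ and the same a: then k′ = j n + k, n′ = (j a + 1) n.
  family : (j : ℕ) → 1 ≤ j → Σ (Digraph ((j * a + 1) * N)) (λ A →
             IsDSRG A (j * N + K) (j * (K + 1) + mu + 1) (j * (K + 1) + mu) (j * (K + 1) + mu))
  family j _ = subst₂ (λ order degree → Σ (Digraph order) (λ A → IsDSRG A degree (μ′ + 1) μ′ μ′))
                      (sym (order≡ a′ mu j)) (sym (degree≡ a′ mu j))
                      (Γ _ _ , Jorgensen.Γ-isDSRG a′ μ′)
    where
    μ′ : ℕ
    μ′ = j * (K + 1) + mu
    order≡ : ∀ a′ mu j → (j * suc a′ + 1) * (suc a′ * suc (suc (suc a′ * mu)))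
                        ≡ suc a′ * suc (suc (suc a′ * (j * (suc (suc a′ * mu) + 1) + mu)))
    order≡ = solve-∀
    degree≡ : ∀ a′ mu j → j * (suc a′ * suc (suc (suc a′ * mu))) + suc (suc a′ * mu)
                         ≡ suc (suc a′ * (j * (suc (suc a′ * mu) + 1) + mu))
    degree≡ = solve-∀

reparametrise : ∀ {k mu n a} → 2 ≤ k → 1 ≤ mu → n * mu ≡ k * k ∸ 1 → a * mu ≡ k ∸ 1 →
  Σ ℕ (λ a′ → a ≡ suc a′) × k ≡ suc (a * mu) × n ≡ a * suc k
reparametrise {suc k′} {suc _} {_} {zero} (s≤s 1≤k′) _ _ 0≡k′ = ⊥-elim (1+n≰n (≤-trans 1≤k′ (≤-reflexive (sym 0≡k′))))
reparametrise {suc k′} {mu@(suc _)} {n} {a@(suc a′)} _ _ hn ha = (a′ , refl) , cong suc (sym ha) , *-cancelʳ-≡ n (a * suc (suc k′)) mu (begin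
  n * mu                    ≡⟨ hn ⟩
  suc k′ * suc k′ ∸ 1       ≡⟨ cong (_∸ 1) (square k′) ⟩
  k′ * suc (suc k′)         ≡⟨ cong (_* suc (suc k′)) ha ⟨
  a * mu * suc (suc k′)     ≡⟨ swap a mu (suc (suc k′)) ⟩
  a * suc (suc k′) * mu     ∎)
  where
  open ≡-Reasoning
  square : ∀ k′ → suc k′ * suc k′ ≡ suc (k′ * suc (suc k′))
  square = solve-∀
  swap : ∀ x y z → x * y * z ≡ x * z * y
  swap = solve-∀

lemma1 : (k mu n a : ℕ) → 2 ≤ k → 1 ≤ mu → mu ∣ k ∸ 1
    → n * mu ≡ k * k ∸ 1 → a * mu ≡ k ∸ 1
    → IsColumnEquitable (Γ n k) a (λ i → Cpart n k (toℕ i)) (Qmat a mu)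
    × ((j : ℕ) → 1 ≤ j
    → Σ (Digraph ((j * a + 1) * n)) (λ A →
    IsDSRG A (j * n + k) (j * (k + 1) + mu + 1) (j * (k + 1) + mu) (j * (k + 1) + mu)))
lemma1 k mu n a 2≤k 1≤mu _ hn ha with reparametrise {k} {mu} {n} {a} 2≤k 1≤mu hn ha
... | (a′ , refl) , refl , refl = jorgensen-parametrised a′ mu
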